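{- Let $k\ge1$ and $a\in\{1,\dots,k\}$. Let $p_1$ be the partially ordered pattern of length $k$ whose poset on $\{1,\dots,k\}$ has relations exactly $j<a$ for all $j\ne a$ (all other pairs incomparable), and let $p_2$ be the partially ordered pattern of length $k$ whose poset has relations exactly $k<j$ for all $j\in\{1,\dots,k-1\}$ (all other pairs incomparable). Then $p_1$ and $p_2$ are shape-Wilf-equivalent.
   Context: A partially ordered pattern (POP) $p$ of length $k$ is a partial order $P$ on $\{1,\dots,k\}$. An occurrence of $p$ in a permutation $\pi_1\cdots\pi_n$ is a subsequence $\pi_{i_1}\cdots\pi_{i_k}$ ($i_1<\dots<i_k$) such that $\pi_{i_j}<\pi_{i_m}$ whenever $j<m$ in $P$. Equivalently, avoiding $p$ means avoiding every classical pattern $q\in S_k$ with $q_j<q_m$ whenever $j<_P m$; avoidance of a POP in a filling means avoidance of all these classical patterns. A Ferrers board is a finite bottom-left-justified array of unit squares in which the number of squares in each row is at most the number in the row below (a set $F$ of cells $(i,j)$, column $i$, row $j$, closed under decreasing either coordinate). A filling of $F$ assigns $0$'s and $1$'s to its cells so that every row and every column of $F$ has exactly one $1$. A filling contains a classical pattern $q$ of length $k$ if there are columns $c_1<\dots<c_k$ and rows $r_1<\dots<r_k$ with all cells $(c_a,r_b)$ in $F$ such that the filling restricted to these cells has a $1$ at $(c_a,r_b)$ exactly when $q_a=b$. Two (sets of) patterns are shape-Wilf-equivalent if for every Ferrers board $F$ the numbers of fillings of $F$ avoiding them are equal. -}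

module Defs where

open import Data.Nat using (ℕ; zero; suc; _≤_; _<_)
open import Data.Fin as Fin using (Fin; toℕ)
open import Data.Vec using (Vec; lookup)
open import Data.List using (List; length)
open import Data.List.Membership.Propositional using (_∈_)
open import Data.List.Relation.Unary.Unique.Propositional using (Unique)
open import Data.Product using (Σ; ∃; _×_; _,_)
open import Relation.Binary.PropositionalEquality using (_≡_; _≢_)
open import Relation.Nullary using (¬_)
open import Function.Bundles using (_⇔_)

-- A Ferrers board with n columns is given by its column heights
-- h : Fin n → ℕ (column 0 is the leftmost).  Bottom-left justification / closure under decreasing
-- coordinates means the heights are weakly decreasing from left to right;
-- every column of the array contains at least one square.

record Board : Set where
  field
    n       : ℕ
    h       : Fin n → ℕ
    weakly-decreasing : ∀ {i j : Fin n} → toℕ i ≤ toℕ j → h j ≤ h i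
    positive : ∀ (i : Fin n) → 1 ≤ h i
open Board public

rowsOf : (n : ℕ) → (Fin n → ℕ) → ℕ
rowsOf zero    h = 0
rowsOf (suc n) h = h Fin.zero

rows : Board → ℕ
rows B = rowsOf (n B) (h B)

InBoard : (B : Board) → Fin (n B) → ℕ → Set
InBoard B c r = r < h B c

-- A 0/1 filling with exactly one 1 in every column is recorded by the
-- vector v giving, for each column c, the row (lookup v c) of its 1.
-- It is a filling of B iff every 1 lies in a cell of B and every row has
-- exactly one 1 (v injective and surjective onto the rows).

Arrangement : Board → Set
Arrangement B = Vec (Fin (rows B)) (n B)

IsFilling : (B : Board) → Arrangement B → Set
IsFilling B v =
  (∀ c → InBoard B c (toℕ (lookup v c))) ×
  (∀ c d → lookup v c ≡ lookup v d → c ≡ d) ×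
  (∀ r → ∃ λ c → lookup v c ≡ r)

StrictlyIncreasing : ∀ {k m} → Vec (Fin m) k → Set
StrictlyIncreasing {k} xs =
  ∀ (a b : Fin k) → toℕ a < toℕ b → toℕ (lookup xs a) < toℕ (lookup xs b)

IsPermutation : ∀ {k} → Vec (Fin k) k → Set
IsPermutation {k} q =
  (∀ a b → lookup q a ≡ lookup q b → a ≡ b) × (∀ b → ∃ λ a → lookup q a ≡ b)

ContainsClassical : ∀ (B : Board) {k} → Vec (Fin k) k → Arrangement B → Set
ContainsClassical B {k} q v =
  Σ (Vec (Fin (n B)) k) λ cs →
  Σ (Vec (Fin (rows B)) k) λ rs →
    StrictlyIncreasing cs × StrictlyIncreasing rs ×
    (∀ a b → InBoard B (lookup cs a) (toℕ (lookup rs b))) ×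
    (∀ a b → (lookup v (lookup cs a) ≡ lookup rs b) ⇔ (lookup q a ≡ b))

-- Partially ordered patterns.
-- A POP of length k is given by its strict order relation _<P_ on Fin k
-- (j <P m meaning "j < m in P").

POP : ℕ → Set₁
POP k = Fin k → Fin k → Set

CompatibleWith : ∀ {k} → POP k → Vec (Fin k) k → Set
CompatibleWith {k} P q =
  ∀ (j m : Fin k) → P j m → toℕ (lookup q j) < toℕ (lookup q m)

AvoidsPOP : ∀ (B : Board) {k} → POP k → Arrangement B → Set
AvoidsPOP B {k} P v =
  ∀ (q : Vec (Fin k) k) → IsPermutation q → CompatibleWith P q →
    ¬ ContainsClassical B q v

Card : {X : Set} → (X → Set) → ℕ → Set
Card {X} A N =
  Σ (List X) λ xs → Unique xs × length xs ≡ N × (∀ x → (x ∈ xs) ⇔ A x)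

AvoidingFillings : (B : Board) → ∀ {k} → POP k → Arrangement B → Set
AvoidingFillings B P v = IsFilling B v × AvoidsPOP B P v

ShapeWilfEquivalent : ∀ {k l} → POP k → POP l → Set
ShapeWilfEquivalent P Q =
  ∀ (B : Board) → ∃ λ N → Card (AvoidingFillings B P) N × Card (AvoidingFillings B Q) N

-- The two POPs of Theorem 3.2 (1-based positions a, k correspond to the
-- 0-based indices a and Fin.last here).

p₁ : ∀ k → Fin (suc k) → POP (suc k)
p₁ k a j m = (m ≡ a) × (j ≢ a)

p₂ : ∀ k → POP (suc k)
p₂ k j m = (j ≡ Fin.fromℕ k) × (m ≢ Fin.fromℕ k)

{-# OPTIONS --safe #-}
-- Both patterns are compared with p₁ k (fromℕ k), whose last entry is its maximum, by
-- showing that on every board the avoiders of each satisfy the same product recursion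
-- (boards with different numbers of rows and columns have no fillings at all).
--
-- For p₁ k a, place the 1 of the top row, which w columns reach. It completes an
-- occurrence exactly when at least a columns lie to its left and at least k − a columns
-- reaching the top row lie to its right, so it has min(w, k) admissible columns, and
-- deleting its row and column always leaves the same board. Hence the number of
-- avoiders does not depend on a.
--
-- For p₂ k and p₁ k (fromℕ k), place instead the 1 of the last column, the shortest
-- one, of height g. It completes an occurrence of p₂ k exactly when at least k cells of
-- that column lie above it, and one of p₁ k (fromℕ k) exactly when at least k lie below
-- it: again min(g, k) admissible rows, and deleting its row and column leaves a fixed
-- board.

module Submission where

open import Defs
open import Data.Empty using (⊥-elim)
open import Data.Fin as Fin using (Fin; toℕ; fromℕ; fromℕ<; punchIn; punchOut)
open import Data.Fin.Properties
  using ( ¬Fin0; toℕ<n; toℕ-injective; toℕ-fromℕ; toℕ-fromℕ<; toℕ≤pred[n]; any?; pigeonhole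
        ; cantor-schröder-bernstein; punchIn-injective; punchInᵢ≢i; punchIn-mono-≤; punchIn-cancel-≤
        ; punchOut-injective; punchOut-cancel-≤; punchIn-punchOut )
open import Data.List as List using (List; []; _∷_; length; filter; allFin; tabulate; cartesianProductWith)
open import Data.List.Membership.Propositional using (_∈_)
open import Data.List.Membership.Propositional.Properties
  using (∈-filter⁺; ∈-filter⁻; ∈-allFin; ∈-cartesianProductWith⁺; ∈-cartesianProductWith⁻)
open import Data.List.Membership.Propositional.Properties.WithK using (unique∧set⇒bag)
open import Data.List.Properties using (length-++; length-map)
open import Data.List.Relation.Binary.BagAndSetEquality using (∼bag⇒↭)
open import Data.List.Relation.Binary.Permutation.Propositional.Properties using (↭-length)
import Data.List.Relation.Unary.All as All
import Data.List.Relation.Unary.AllPairs as AllPairs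
open import Data.List.Relation.Unary.Any using (here)
import Data.List.Relation.Unary.Unique.Propositional.Properties as Unique
open import Data.Nat
  using (ℕ; zero; suc; pred; _≟_; _+_; _*_; _∸_; _⊓_; _≤_; _<_; z≤n; s≤s; s<s; s<s⁻¹; _<?_; _≤?_)
open import Data.Nat.Properties
open import Data.Product using (Σ; ∃; ∃₂; _×_; _,_; proj₁; proj₂)
open import Data.Sum using (_⊎_; inj₁; inj₂)
open import Data.Unit using (⊤; tt)
open import Data.Vec as Vec using (Vec; lookup)
open import Data.Vec.Properties
  using (lookup∘tabulate; tabulate∘lookup; tabulate-cong; lookup-map; insertAt-lookup; insertAt-punchIn)
open import Function using (_∘_; id)
open import Function.Bundles using (_⇔_; mk⇔; Equivalence)
import Function.Properties.Equivalence as ⇔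
open import Relation.Binary.Definitions using (tri<; tri≈; tri>)
open import Relation.Binary.PropositionalEquality
open import Relation.Nullary using (¬_; yes; no)
open import Relation.Nullary.Decidable using (_×-dec_; _⊎-dec_)
open import Relation.Nullary.Negation using (contradiction)
open import Relation.Unary using (Decidable)

open Equivalence using (to; from)

Card-empty : ∀ {X : Set} {A : X → Set} → (∀ x → ¬ A x) → Card A 0
Card-empty ¬A = [] , AllPairs.[] , refl , λ x → mk⇔ (λ ()) (⊥-elim ∘ ¬A x)

Card-unique : ∀ {X : Set} {A : X → Set} {M N} → Card A M → Card A N → M ≡ N
Card-unique (xs , xs! , refl , ∈xs) (ys , ys! , refl , ∈ys) =
  ↭-length (∼bag⇒↭ (unique∧set⇒bag xs! ys! λ {x} → ⇔.trans (∈xs x) (⇔.sym (∈ys x))))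

length-cartesianProductWith : ∀ {I Y X : Set} (f : I → Y → X) (is : List I) (ys : List Y) →
  length (cartesianProductWith f is ys) ≡ length is * length ys
length-cartesianProductWith f []       ys = refl
length-cartesianProductWith f (i ∷ is) ys = begin
  length (List.map (f i) ys List.++ cartesianProductWith f is ys)  ≡⟨ length-++ (List.map (f i) ys) ⟩
  length (List.map (f i) ys) + length (cartesianProductWith f is ys)
    ≡⟨ cong₂ _+_ (length-map (f i) ys) (length-cartesianProductWith f is ys) ⟩
  length ys + length is * length ys  ∎
  where open ≡-Reasoning

Card-product : ∀ {I Y X : Set} {S : I → Set} {B : Y → Set} {A : X → Set} {s N}
  (f : I → Y → X) → (∀ {i j y z} → f i y ≡ f j z → i ≡ j × y ≡ z) →
  (∀ x → A x ⇔ (∃₂ λ i y → S i × B y × x ≡ f i y)) →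
  Card S s → Card B N → Card A (s * N)
Card-product {A = A} f f-injective A⇔ (is , is! , refl , ∈is) (ys , ys! , refl , ∈ys) =
  cartesianProductWith f is ys ,
  Unique.cartesianProductWith⁺ f f-injective is! ys! ,
  length-cartesianProductWith f is ys ,
  λ x → mk⇔ (sound x) (complete x)
  where
  sound : ∀ x → x ∈ cartesianProductWith f is ys → A x
  sound x x∈ with i , y , i∈ , y∈ , refl ← ∈-cartesianProductWith⁻ f is ys x∈ =
    from (A⇔ x) (i , y , to (∈is i) i∈ , to (∈ys y) y∈ , refl)
  complete : ∀ x → A x → x ∈ cartesianProductWith f is ys
  complete x Ax with i , y , Si , By , refl ← to (A⇔ x) Ax =
    ∈-cartesianProductWith⁺ f (from (∈is i) Si) (from (∈ys y) By)

count : ∀ {n} {P : Fin n → Set} → Decidable P → ℕ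
count {zero} P? = 0
count {suc n} P? with P? Fin.zero
... | yes _ = suc (count (P? ∘ Fin.suc))
... | no  _ = count (P? ∘ Fin.suc)

length-filter-tabulate : ∀ {A : Set} {n} {P : A → Set} (P? : Decidable P) (f : Fin n → A) →
  length (filter P? (tabulate f)) ≡ count (P? ∘ f)
length-filter-tabulate {n = zero}  P? f = refl
length-filter-tabulate {n = suc n} P? f with P? (f Fin.zero)
... | yes _ = cong suc (length-filter-tabulate P? (f ∘ Fin.suc))
... | no  _ = length-filter-tabulate P? (f ∘ Fin.suc)

Card-count : ∀ {n} {P : Fin n → Set} (P? : Decidable P) → Card P (count P?)
Card-count {n} P? =
  filter P? (allFin n) , Unique.filter⁺ P? {allFin n} (Unique.allFin⁺ n) , length-filter-tabulate P? id ,
  λ i → mk⇔ (proj₂ ∘ ∈-filter⁻ P? {xs = allFin n}) (∈-filter⁺ P? (∈-allFin i))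

count-mono : ∀ {n} {P Q : Fin n → Set} (P? : Decidable P) (Q? : Decidable Q) →
  (∀ i → P i → Q i) → count P? ≤ count Q?
count-mono {zero}  P? Q? P⊆Q = z≤n
count-mono {suc n} P? Q? P⊆Q with P? Fin.zero | Q? Fin.zero
... | yes _ | yes _  = s≤s (count-mono (P? ∘ Fin.suc) (Q? ∘ Fin.suc) (P⊆Q ∘ Fin.suc))
... | yes p | no ¬q  = contradiction (P⊆Q Fin.zero p) ¬q
... | no _  | yes _  = m≤n⇒m≤1+n (count-mono (P? ∘ Fin.suc) (Q? ∘ Fin.suc) (P⊆Q ∘ Fin.suc))
... | no _  | no _   = count-mono (P? ∘ Fin.suc) (Q? ∘ Fin.suc) (P⊆Q ∘ Fin.suc)

count-mono-< : ∀ {n} {P Q : Fin n → Set} (P? : Decidable P) (Q? : Decidable Q) →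
  (∀ i → P i → Q i) → ∀ j → Q j → ¬ P j → count P? < count Q?
count-mono-< {suc n} P? Q? P⊆Q j Qj ¬Pj with P? Fin.zero | Q? Fin.zero | j
... | yes p | _     | Fin.zero  = contradiction p ¬Pj
... | no _  | yes _ | Fin.zero  = s≤s (count-mono (P? ∘ Fin.suc) (Q? ∘ Fin.suc) (P⊆Q ∘ Fin.suc))
... | no _  | no ¬q | Fin.zero  = contradiction Qj ¬q
... | yes _ | yes _ | Fin.suc j = s≤s (count-mono-< (P? ∘ Fin.suc) (Q? ∘ Fin.suc) (P⊆Q ∘ Fin.suc) j Qj ¬Pj)
... | yes p | no ¬q | Fin.suc _ = contradiction (P⊆Q Fin.zero p) ¬q
... | no _  | yes _ | Fin.suc j = m<n⇒m<1+n (count-mono-< (P? ∘ Fin.suc) (Q? ∘ Fin.suc) (P⊆Q ∘ Fin.suc) j Qj ¬Pj)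
... | no _  | no _  | Fin.suc j = count-mono-< (P? ∘ Fin.suc) (Q? ∘ Fin.suc) (P⊆Q ∘ Fin.suc) j Qj ¬Pj

count-cong : ∀ {n} {P Q : Fin n → Set} (P? : Decidable P) (Q? : Decidable Q) →
  (∀ i → P i ⇔ Q i) → count P? ≡ count Q?
count-cong P? Q? P⇔Q = ≤-antisym (count-mono P? Q? (to ∘ P⇔Q)) (count-mono Q? P? (from ∘ P⇔Q))

count-all : ∀ {n} {P : Fin n → Set} (P? : Decidable P) → (∀ i → P i) → count P? ≡ n
count-all {zero}  P? all = refl
count-all {suc n} P? all with P? Fin.zero
... | yes _ = cong suc (count-all (P? ∘ Fin.suc) (all ∘ Fin.suc))
... | no ¬p = contradiction (all Fin.zero) ¬p

count-none : ∀ {n} {P : Fin n → Set} (P? : Decidable P) → (∀ i → ¬ P i) → count P? ≡ 0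
count-none {zero}  P? none = refl
count-none {suc n} P? none with P? Fin.zero
... | yes p = contradiction p (none Fin.zero)
... | no _  = count-none (P? ∘ Fin.suc) (none ∘ Fin.suc)

count-+ : ∀ x y {Q : ℕ → Set} (Q? : Decidable Q) →
  count {x + y} (Q? ∘ toℕ) ≡ count {x} (Q? ∘ toℕ) + count {y} (λ i → Q? (x + toℕ i))
count-+ zero    y Q? = refl
count-+ (suc x) y Q? with Q? 0
... | yes _ = cong suc (count-+ x y (Q? ∘ suc))
... | no  _ = count-+ x y (Q? ∘ suc)

count-< : ∀ s a → count {s} ((_<? a) ∘ toℕ) ≡ s ⊓ a
count-< zero    a       = refl
count-< (suc s) zero    = count-none {suc s} ((_<? 0) ∘ toℕ) (λ _ ())
count-< (suc s) (suc a) = cong suc (begin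
  count {s} (λ i → suc (toℕ i) <? suc a)
    ≡⟨ count-cong {s} (λ i → suc (toℕ i) <? suc a) ((_<? a) ∘ toℕ) (λ _ → mk⇔ s<s⁻¹ s<s) ⟩
  count {s} ((_<? a) ∘ toℕ)
    ≡⟨ count-< s a ⟩
  s ⊓ a
    ∎)
  where open ≡-Reasoning

count-restrict : ∀ {n w} {Q : ℕ → Set} (Q? : Decidable Q) → w ≤ n →
  count {n} (λ i → (toℕ i <? w) ×-dec Q? (toℕ i)) ≡ count {w} (Q? ∘ toℕ)
count-restrict {n} {w} {Q} Q? w≤n = begin
  count {n} (R? ∘ toℕ)
    ≡⟨ cong (λ l → count {l} (R? ∘ toℕ)) (sym (m+[n∸m]≡n w≤n)) ⟩
  count {w + (n ∸ w)} (R? ∘ toℕ)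
    ≡⟨ count-+ w (n ∸ w) R? ⟩
  count {w} (R? ∘ toℕ) + count {n ∸ w} (λ i → R? (w + toℕ i))
    ≡⟨ cong₂ _+_ (count-cong (R? ∘ toℕ) (Q? ∘ toℕ) (λ i → mk⇔ proj₂ (toℕ<n i ,_)))
                 (count-none {n ∸ w} (λ i → R? (w + toℕ i)) (λ i → m+n≮m w (toℕ i) ∘ proj₁)) ⟩
  count {w} (Q? ∘ toℕ) + 0
    ≡⟨ +-identityʳ _ ⟩
  count {w} (Q? ∘ toℕ)
    ∎
  where
  open ≡-Reasoning
  R? : Decidable (λ x → x < w × Q x)
  R? x = (x <? w) ×-dec Q? x

-- Position i of 0, …, w − 1 has fewer than A positions before it or fewer than D after it,
-- so an entry with A entries on its left and D on its right cannot be placed there.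
Unblocked : (w A D i : ℕ) → Set
Unblocked w A D i = i < A ⊎ w ≤ i + D

unblocked? : ∀ w A D → Decidable (Unblocked w A D)
unblocked? w A D i = (i <? A) ⊎-dec (w ≤? i + D)

count-Unblocked : ∀ w A D → count {w} (unblocked? w A D ∘ toℕ) ≡ w ⊓ (A + D)
count-Unblocked w A D with ≤-total D w
... | inj₂ w≤D = begin
  count {w} (unblocked? w A D ∘ toℕ)
    ≡⟨ count-all (unblocked? w A D ∘ toℕ) (λ i → inj₂ (≤-trans w≤D (m≤n+m D (toℕ i)))) ⟩
  w
    ≡⟨ m≤n⇒m⊓n≡m (≤-trans w≤D (m≤n+m D A)) ⟨
  w ⊓ (A + D)
    ∎
  where open ≡-Reasoning
... | inj₁ D≤w = begin
  count {w} (unblocked? w A D ∘ toℕ)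
    ≡⟨ cong (λ l → count {l} (unblocked? w A D ∘ toℕ)) (sym s+D≡w) ⟩
  count {s + D} (unblocked? w A D ∘ toℕ)
    ≡⟨ count-+ s D (unblocked? w A D) ⟩
  count {s} (unblocked? w A D ∘ toℕ) + count {D} (λ i → unblocked? w A D (s + toℕ i))
    ≡⟨ cong₂ _+_ (count-cong (unblocked? w A D ∘ toℕ) ((_<? A) ∘ toℕ) (λ i → mk⇔ (left (toℕ<n i)) inj₁))
                 (count-all {D} (λ i → unblocked? w A D (s + toℕ i)) (λ i → inj₂ (right (toℕ i)))) ⟩
  count {s} ((_<? A) ∘ toℕ) + D        ≡⟨ cong (_+ D) (count-< s A) ⟩
  s ⊓ A + D                            ≡⟨ +-distribʳ-⊓ D s A ⟩
  (s + D) ⊓ (A + D)                    ≡⟨ cong (_⊓ (A + D)) s+D≡w ⟩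
  w ⊓ (A + D)                          ∎
  where
  open ≡-Reasoning
  s = w ∸ D
  s+D≡w : s + D ≡ w
  s+D≡w = m∸n+n≡m D≤w
  left : ∀ {i} → i < s → Unblocked w A D i → i < A
  left i<s (inj₁ i<A)    = i<A
  left i<s (inj₂ w≤i+D) = contradiction (subst (_≤ _ + D) (sym s+D≡w) w≤i+D) (<⇒≱ (+-monoˡ-< D i<s))
  right : ∀ i → w ≤ s + i + D
  right i = subst (_≤ s + i + D) s+D≡w (+-monoˡ-≤ D (m≤m+n s i))

Card-unblocked : ∀ {n w} A D → w ≤ n →
  Card (λ (i : Fin n) → toℕ i < w × Unblocked w A D (toℕ i)) (w ⊓ (A + D))
Card-unblocked {w = w} A D w≤n =
  subst (Card _) (trans (count-restrict (unblocked? w A D) w≤n) (count-Unblocked w A D))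
    (Card-count (λ i → (toℕ i <? w) ×-dec unblocked? w A D (toℕ i)))

injective⇒surjective : ∀ {K} (f : Fin K → Fin K) → (∀ {i j} → f i ≡ f j → i ≡ j) →
  ∀ b → ∃ λ i → f i ≡ b
injective⇒surjective {suc K} f f-injective b with any? (λ i → f i Fin.≟ b)
... | yes found = found
... | no ¬found
  with i , j , i<j , eq ← pigeonhole (n<1+n K) (λ i → punchOut {i = b} {j = f i} (¬found ∘ (i ,_) ∘ sym))
  = contradiction (cong toℕ (f-injective (punchOut-injective {i = b} _ _ eq))) (<⇒≢ i<j)

lookup-extensionality : ∀ {A : Set} {n} {xs ys : Vec A n} → (∀ i → lookup xs i ≡ lookup ys i) → xs ≡ ys
lookup-extensionality {xs = xs} {ys} eq =
  trans (sym (tabulate∘lookup xs)) (trans (tabulate-cong eq) (tabulate∘lookup ys))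

punchIn-cases : ∀ {m} (c x : Fin (suc m)) → x ≡ c ⊎ ∃ λ j → x ≡ punchIn c j
punchIn-cases c x with c Fin.≟ x
... | yes c≡x = inj₁ (sym c≡x)
... | no  c≢x = inj₂ (punchOut c≢x , sym (punchIn-punchOut c≢x))

punchIn-mono-< : ∀ {m} (i : Fin (suc m)) {j j′ : Fin m} →
  toℕ j < toℕ j′ → toℕ (punchIn i j) < toℕ (punchIn i j′)
punchIn-mono-< i {j} {j′} j<j′ = ≰⇒> (<⇒≱ j<j′ ∘ punchIn-cancel-≤ i j′ j)

punchOut-mono-< : ∀ {m} {i j j′ : Fin (suc m)} (i≢j : i ≢ j) (i≢j′ : i ≢ j′) →
  toℕ j < toℕ j′ → toℕ (punchOut i≢j) < toℕ (punchOut i≢j′)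
punchOut-mono-< i≢j i≢j′ j<j′ = ≰⇒> (<⇒≱ j<j′ ∘ punchOut-cancel-≤ i≢j′ i≢j)

punchIn-below-or-suc : ∀ {m} (i : Fin (suc m)) (j : Fin m) →
  (toℕ j < toℕ i × toℕ (punchIn i j) ≡ toℕ j) ⊎ punchIn i j ≡ Fin.suc j
punchIn-below-or-suc Fin.zero    j           = inj₂ refl
punchIn-below-or-suc (Fin.suc i) Fin.zero    = inj₁ (s≤s z≤n , refl)
punchIn-below-or-suc (Fin.suc i) (Fin.suc j) with punchIn-below-or-suc i j
... | inj₁ (j<i , eq) = inj₁ (s<s j<i , cong suc eq)
... | inj₂ eq         = inj₂ (cong Fin.suc eq)

toℕ-punchIn-fromℕ : ∀ {m} (j : Fin m) → toℕ (punchIn (fromℕ m) j) ≡ toℕ j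
toℕ-punchIn-fromℕ {suc m} Fin.zero    = refl
toℕ-punchIn-fromℕ {suc m} (Fin.suc j) = cong suc (toℕ-punchIn-fromℕ j)

initialSegment : ∀ {n} (P : Fin n → Set) → Decidable P → (∀ {d d′} → P d → toℕ d′ ≤ toℕ d → P d′) →
  ∃ λ w → w ≤ n × ∀ d → P d ⇔ toℕ d < w
initialSegment {zero}  P P? closed = 0 , z≤n , λ ()
initialSegment {suc n} P P? closed with P? Fin.zero
... | no ¬P0 = 0 , z≤n , λ d → mk⇔ (λ Pd → contradiction (closed Pd z≤n) ¬P0) (λ ())
... | yes P0
  with w , w≤n , P∘suc⇔ ← initialSegment (P ∘ Fin.suc) (P? ∘ Fin.suc) (λ Pd d′≤d → closed Pd (s≤s d′≤d))
  = suc w , s≤s w≤n , λ where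
      Fin.zero    → mk⇔ (λ _ → s≤s z≤n) (λ _ → P0)
      (Fin.suc d) → mk⇔ (s<s ∘ to (P∘suc⇔ d)) (from (P∘suc⇔ d) ∘ s<s⁻¹)

module _ {k m} (s : Vec (Fin m) k) (s-increasing : StrictlyIncreasing s) where

  strictlyIncreasing-injective : ∀ {a b} → lookup s a ≡ lookup s b → a ≡ b
  strictlyIncreasing-injective {a} {b} sa≡sb with <-cmp (toℕ a) (toℕ b)
  ... | tri< a<b _ _ = contradiction (cong toℕ sa≡sb) (<⇒≢ (s-increasing a b a<b))
  ... | tri≈ _ a≡b _ = toℕ-injective a≡b
  ... | tri> _ _ b<a = contradiction (cong toℕ sa≡sb) (≢-sym (<⇒≢ (s-increasing b a b<a)))

  strictlyIncreasing-reflects-< : ∀ {a b} → toℕ (lookup s a) < toℕ (lookup s b) → toℕ a < toℕ b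
  strictlyIncreasing-reflects-< {a} {b} sa<sb with <-cmp (toℕ a) (toℕ b)
  ... | tri< a<b _ _ = a<b
  ... | tri≈ _ a≡b _ = contradiction (cong (toℕ ∘ lookup s) (toℕ-injective a≡b)) (<⇒≢ sa<sb)
  ... | tri> _ _ b<a = contradiction (s-increasing b a b<a) (<⇒≯ sa<sb)

  strictlyIncreasing-gap : ∀ d {a b : Fin k} → toℕ b ≡ toℕ a + d →
    toℕ (lookup s a) + d ≤ toℕ (lookup s b)
  strictlyIncreasing-gap zero {a} {b} b≡a+0
    rewrite toℕ-injective {i = b} {j = a} (trans b≡a+0 (+-identityʳ (toℕ a))) = ≤-reflexive (+-identityʳ _)
  strictlyIncreasing-gap (suc d) {a} {b} b≡a+1+d = begin
    toℕ (lookup s a) + suc d    ≡⟨ +-suc _ d ⟩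
    suc (toℕ (lookup s a) + d)  ≤⟨ s≤s (strictlyIncreasing-gap d (toℕ-fromℕ< b′<k)) ⟩
    suc (toℕ (lookup s b′))     ≤⟨ s-increasing b′ b (subst (_< toℕ b) (sym (toℕ-fromℕ< b′<k)) a+d<b) ⟩
    toℕ (lookup s b)            ∎
    where
    open ≤-Reasoning
    a+d<b : toℕ a + d < toℕ b
    a+d<b = subst (toℕ a + d <_) (sym b≡a+1+d) (≤-reflexive (sym (+-suc (toℕ a) d)))
    b′<k : toℕ a + d < k
    b′<k = <-trans a+d<b (toℕ<n b)
    b′ : Fin k
    b′ = fromℕ< b′<k

strictlyIncreasing-max : ∀ {k m} (s : Vec (Fin (suc m)) (suc k)) → StrictlyIncreasing s →
  ∀ {j} → toℕ (lookup s j) ≡ m → j ≡ fromℕ k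
strictlyIncreasing-max {k} {m} s s-increasing {j} sj≡m with <-cmp (toℕ j) k
... | tri≈ _ j≡k _ = toℕ-injective (trans j≡k (sym (toℕ-fromℕ k)))
... | tri> _ _ k<j = contradiction (toℕ≤pred[n] j) (<⇒≱ k<j)
... | tri< j<k _ _ = contradiction (toℕ≤pred[n] (lookup s (fromℕ k)))
    (<⇒≱ (subst (_< toℕ (lookup s (fromℕ k))) sj≡m
           (s-increasing j (fromℕ k) (subst (toℕ j <_) (sym (toℕ-fromℕ k)) j<k))))

module Rank {K N} (x : Fin K → Fin N) (x-injective : ∀ {i j} → x i ≡ x j → i ≡ j) where

  private
    X : Fin K → ℕ
    X = toℕ ∘ x

    below? : ∀ i → Decidable (λ j → X j < X i)
    below? i j = X j <? X i

    everything? : Decidable (λ (_ : Fin K) → ⊤)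
    everything? _ = yes tt

    count-below<K : ∀ i → count (below? i) < K
    count-below<K i = subst (count (below? i) <_) (count-all everything? _)
      (count-mono-< (below? i) everything? _ i tt (n≮n (X i)))

  rank : Fin K → Fin K
  rank i = fromℕ< (count-below<K i)

  rank-mono : ∀ {i j} → X i < X j → toℕ (rank i) < toℕ (rank j)
  rank-mono {i} {j} xi<xj =
    subst₂ _<_ (sym (toℕ-fromℕ< (count-below<K i))) (sym (toℕ-fromℕ< (count-below<K j)))
      (count-mono-< (below? i) (below? j) (λ _ xl<xi → <-trans xl<xi xi<xj) i xi<xj (n≮n (X i)))

  rank-injective : ∀ {i j} → rank i ≡ rank j → i ≡ j
  rank-injective {i} {j} eq with <-cmp (X i) (X j)
  ... | tri< xi<xj _ _ = contradiction (cong toℕ eq) (<⇒≢ (rank-mono xi<xj))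
  ... | tri≈ _ xi≡xj _ = x-injective (toℕ-injective xi≡xj)
  ... | tri> _ _ xj<xi = contradiction (cong toℕ eq) (≢-sym (<⇒≢ (rank-mono xj<xi)))

  unrank : Fin K → Fin K
  unrank b = proj₁ (injective⇒surjective rank rank-injective b)

  rank-unrank : ∀ b → rank (unrank b) ≡ b
  rank-unrank b = proj₂ (injective⇒surjective rank rank-injective b)

  unrank-rank : ∀ i → unrank (rank i) ≡ i
  unrank-rank i = rank-injective (rank-unrank (rank i))

  unrank-increasing : ∀ {b b′} → toℕ b < toℕ b′ → X (unrank b) < X (unrank b′)
  unrank-increasing {b} {b′} b<b′ with <-cmp (X (unrank b)) (X (unrank b′))
  ... | tri< lt _ _ = lt
  ... | tri≈ _ eq _ =
    contradiction (cong rank (x-injective (toℕ-injective eq)))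
      (λ eq′ → <⇒≢ b<b′ (cong toℕ (trans (sym (rank-unrank b)) (trans eq′ (rank-unrank b′)))))
  ... | tri> _ _ gt =
    contradiction (subst₂ _<_ (cong toℕ (rank-unrank b′)) (cong toℕ (rank-unrank b)) (rank-mono gt)) (<⇒≯ b<b′)

record Standardisation {K N} (x : Fin K → Fin N) : Set where
  field
    ranks             : Vec (Fin K) K
    sorted            : Vec (Fin N) K
    ranks-permutation : IsPermutation ranks
    sorted-increasing : StrictlyIncreasing sorted
    sorted-ranks      : ∀ i → lookup sorted (lookup ranks i) ≡ x i

-- Opaque: only the fields are ever needed, and unfolding the counting behind the ranks
-- makes type checking very slow.
opaque
  standardise : ∀ {K N} (x : Fin K → Fin N) → (∀ {i j} → x i ≡ x j → i ≡ j) → Standardisation x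
  standardise x x-injective = record
    { ranks             = Vec.tabulate rank
    ; sorted            = Vec.tabulate (x ∘ unrank)
    ; ranks-permutation =
        (λ i j eq → rank-injective (trans (sym (lookup∘tabulate rank i)) (trans eq (lookup∘tabulate rank j)))) ,
        (λ b → unrank b , trans (lookup∘tabulate rank (unrank b)) (rank-unrank b))
    ; sorted-increasing = λ b b′ b<b′ →
        subst₂ (λ s t → toℕ s < toℕ t)
          (sym (lookup∘tabulate (x ∘ unrank) b)) (sym (lookup∘tabulate (x ∘ unrank) b′)) (unrank-increasing b<b′)
    ; sorted-ranks      = λ i → trans (lookup∘tabulate (x ∘ unrank) _)
        (trans (cong (x ∘ unrank) (lookup∘tabulate rank i)) (cong x (unrank-rank i)))
    }
    where open Rank x x-injective

-- The notions of Defs for a board given only by its column heights, with the number R of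
-- rows decoupled from them, so that rows and columns can be deleted recursively.

Shape : ℕ → Set
Shape n = Fin n → ℕ

Decreasing : ∀ {n} → Shape n → Set
Decreasing {n} H = ∀ {i j : Fin n} → toℕ i ≤ toℕ j → H j ≤ H i

IsFillingOf : ∀ {n R} → Shape n → Vec (Fin R) n → Set
IsFillingOf H v =
  (∀ c → toℕ (lookup v c) < H c) ×
  (∀ c d → lookup v c ≡ lookup v d → c ≡ d) ×
  (∀ r → ∃ λ c → lookup v c ≡ r)

Occurrence : ∀ {n R k} → Shape n → Vec (Fin k) k → Vec (Fin R) n → Set
Occurrence {n} {R} {k} H q v =
  Σ (Vec (Fin n) k) λ cs →
  Σ (Vec (Fin R) k) λ rs →
    StrictlyIncreasing cs × StrictlyIncreasing rs ×
    (∀ a b → toℕ (lookup rs b) < H (lookup cs a)) ×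
    (∀ a b → (lookup v (lookup cs a) ≡ lookup rs b) ⇔ (lookup q a ≡ b))

Avoids : ∀ {n R k} → Shape n → POP k → Vec (Fin R) n → Set
Avoids H P v = ∀ q → IsPermutation q → CompatibleWith P q → ¬ Occurrence H q v

Avoiding : ∀ {n R k} → Shape n → POP k → Vec (Fin R) n → Set
Avoiding H P v = IsFillingOf H v × Avoids H P v

ContainsPOP : ∀ {n R k} → Shape n → POP k → Vec (Fin R) n → Set
ContainsPOP H P v = ∃ λ q → IsPermutation q × CompatibleWith P q × Occurrence H q v

Equinumerous : ∀ {n k l} (R : ℕ) → Shape n → POP k → POP l → Set
Equinumerous R H P Q = ∃ λ N → Card (Avoiding {R = R} H P) N × Card (Avoiding {R = R} H Q) N

Card-avoiding-empty : ∀ {k} (H : Shape 0) (P : POP (suc k)) → Card (Avoiding {R = 0} H P) 1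
Card-avoiding-empty H P =
  Vec.[] ∷ [] , (All.[] AllPairs.∷ AllPairs.[]) , refl ,
  λ { Vec.[] → mk⇔ (λ _ → ((λ ()) , (λ ()) , (λ ())) , λ _ _ _ (cs , _) → ¬Fin0 (lookup cs Fin.zero))
                   (λ _ → here refl) }

filling-square : ∀ {n R} {H : Shape n} {v : Vec (Fin R) n} → IsFillingOf H v → n ≡ R
filling-square {v = v} (_ , injective , surjective) =
  cantor-schröder-bernstein {f = lookup v} {g = proj₁ ∘ surjective} (injective _ _)
    (λ {r} {r′} eq → trans (sym (proj₂ (surjective r))) (trans (cong (lookup v) eq) (proj₂ (surjective r′))))

equinumerous-nonSquare : ∀ {n R k l} {H : Shape n} {P : POP k} {Q : POP l} → n ≢ R → Equinumerous R H P Q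
equinumerous-nonSquare {H = H} n≢R = 0 , Card-empty non-filling , Card-empty non-filling
  where
  non-filling : ∀ {k} {P : POP k} v → ¬ Avoiding H P v
  non-filling v = n≢R ∘ filling-square {v = v} ∘ proj₁

containsPOP-from-columns : ∀ {n R k} {H : Shape n} {P : POP k} {v : Vec (Fin R) n} →
  (∀ c d → lookup v c ≡ lookup v d → c ≡ d) →
  (cs : Vec (Fin n) k) → StrictlyIncreasing cs →
  (∀ a b → toℕ (lookup v (lookup cs b)) < H (lookup cs a)) →
  (∀ a b → P a b → toℕ (lookup v (lookup cs a)) < toℕ (lookup v (lookup cs b))) →
  ContainsPOP H P v
containsPOP-from-columns {H = H} {P} {v} v-injective cs cs-increasing inside respects =
  ranks , ranks-permutation , compatible , (cs , sorted , cs-increasing , sorted-increasing , inside′ , matches)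
  where
  x = λ a → lookup v (lookup cs a)
  open Standardisation (standardise x (λ eq → strictlyIncreasing-injective cs cs-increasing (v-injective _ _ eq)))
  compatible : CompatibleWith P ranks
  compatible a b Pab = strictlyIncreasing-reflects-< sorted sorted-increasing
    (subst₂ (λ y z → toℕ y < toℕ z) (sym (sorted-ranks a)) (sym (sorted-ranks b)) (respects a b Pab))
  inside′ : ∀ a b → toℕ (lookup sorted b) < H (lookup cs a)
  inside′ a b with i , rank-i≡b ← proj₂ ranks-permutation b =
    subst (λ r → toℕ r < H (lookup cs a)) (trans (sym (sorted-ranks i)) (cong (lookup sorted) rank-i≡b))
      (inside a i)
  matches : ∀ a b → (x a ≡ lookup sorted b) ⇔ (lookup ranks a ≡ b)
  matches a b = mk⇔
    (λ xa≡sb → strictlyIncreasing-injective sorted sorted-increasing (trans (sorted-ranks a) xa≡sb))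
    (λ rank-a≡b → trans (sym (sorted-ranks a)) (cong (lookup sorted) rank-a≡b))

module _ {k} {P : POP (suc k)} (q : Vec (Fin (suc k)) (suc k))
         (q-permutation : IsPermutation q) (q-compatible : CompatibleWith P q) where

  compatible-top : ∀ {i} → (∀ j → j ≢ i → P j i) → lookup q i ≡ fromℕ k
  compatible-top {i} below-i with j , qj≡k ← proj₂ q-permutation (fromℕ k) | j Fin.≟ i
  ... | yes refl = qj≡k
  ... | no  j≢i  = contradiction
    (subst (λ t → toℕ t < toℕ (lookup q i)) qj≡k (q-compatible j i (below-i j j≢i)))
    (≤⇒≯ (subst (toℕ (lookup q i) ≤_) (sym (toℕ-fromℕ k)) (toℕ≤pred[n] (lookup q i))))

  compatible-bottom : ∀ {i} → (∀ j → j ≢ i → P i j) → lookup q i ≡ Fin.zero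
  compatible-bottom {i} above-i with j , qj≡0 ← proj₂ q-permutation Fin.zero | j Fin.≟ i
  ... | yes refl = qj≡0
  ... | no  j≢i  = contradiction
    (subst (λ t → toℕ (lookup q i) < toℕ t) qj≡0 (q-compatible i j (above-i j j≢i)))
    (λ ())

insertCell : ∀ {m} → Fin (suc m) → Fin (suc m) → Vec (Fin m) m → Vec (Fin (suc m)) (suc m)
insertCell c r y = Vec.insertAt (Vec.map (punchIn r) y) c r

lookup-insertCell : ∀ {m} c r (y : Vec (Fin m) m) → lookup (insertCell c r y) c ≡ r
lookup-insertCell c r y = insertAt-lookup _ c r

lookup-insertCell-punchIn : ∀ {m} c r (y : Vec (Fin m) m) j →
  lookup (insertCell c r y) (punchIn c j) ≡ punchIn r (lookup y j)
lookup-insertCell-punchIn c r y j = trans (insertAt-punchIn _ c r j) (lookup-map j (punchIn r) y)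

insertCell-injective-atRow : ∀ {m c c′ r} {y y′ : Vec (Fin m) m} →
  insertCell c r y ≡ insertCell c′ r y′ → c ≡ c′ × y ≡ y′
insertCell-injective-atRow {c = c} {c′} {r} {y} {y′} eq with punchIn-cases c′ c
... | inj₁ refl = refl , lookup-extensionality λ j → punchIn-injective r _ _
  (trans (sym (lookup-insertCell-punchIn c r y j))
    (trans (cong (λ v → lookup v (punchIn c j)) eq) (lookup-insertCell-punchIn c r y′ j)))
... | inj₂ (j , refl) = contradiction
  (trans (sym (lookup-insertCell-punchIn c′ r y′ j))
    (trans (cong (λ v → lookup v (punchIn c′ j)) (sym eq)) (lookup-insertCell (punchIn c′ j) r y)))
  (punchInᵢ≢i r (lookup y′ j))

insertCell-injective-atColumn : ∀ {m c r r′} {y y′ : Vec (Fin m) m} →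
  insertCell c r y ≡ insertCell c r′ y′ → r ≡ r′ × y ≡ y′
insertCell-injective-atColumn {c = c} {r} {r′} {y} {y′} eq
  with refl ← trans (sym (lookup-insertCell c r y)) (trans (cong (λ v → lookup v c) eq) (lookup-insertCell c r′ y′))
  = refl , proj₂ (insertCell-injective-atRow eq)

removeCell : ∀ {m} (v : Vec (Fin (suc m)) (suc m)) → (∀ c d → lookup v c ≡ lookup v d → c ≡ d) →
  ∀ c → ∃ λ y → v ≡ insertCell c (lookup v c) y
removeCell {m} v v-injective c = y , lookup-extensionality agree
  where
  r = lookup v c
  r≢ : ∀ j → r ≢ lookup v (punchIn c j)
  r≢ j r≡ = punchInᵢ≢i c j (sym (v-injective _ _ r≡))
  y = Vec.tabulate (λ j → punchOut (r≢ j))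
  agree : ∀ x → lookup v x ≡ lookup (insertCell c r y) x
  agree x with punchIn-cases c x
  ... | inj₁ refl = sym (lookup-insertCell c r y)
  ... | inj₂ (j , refl) = begin
    lookup v (punchIn c j)                  ≡⟨ punchIn-punchOut (r≢ j) ⟨
    punchIn r (punchOut (r≢ j))             ≡⟨ cong (punchIn r) (lookup∘tabulate (λ j → punchOut (r≢ j)) j) ⟨
    punchIn r (lookup y j)                  ≡⟨ lookup-insertCell-punchIn c r y j ⟨
    lookup (insertCell c r y) (punchIn c j) ∎
    where open ≡-Reasoning

Minor : ∀ {m} → Shape (suc m) → Fin (suc m) → Fin (suc m) → Shape m → Set
Minor H c r H′ = ∀ j s → toℕ s < H′ j ⇔ toℕ (punchIn r s) < H (punchIn c j)

module _ {m} {H : Shape (suc m)} {c r : Fin (suc m)} {H′ : Shape m} (minor : Minor H c r H′)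
         (y : Vec (Fin m) m) where

  private
    v = insertCell c r y
    v-punchIn = lookup-insertCell-punchIn c r y

    v-punchIn≢r : ∀ j → lookup v (punchIn c j) ≢ r
    v-punchIn≢r j eq = punchInᵢ≢i r (lookup y j) (trans (sym (v-punchIn j)) eq)

  isFilling-insertCell : toℕ r < H c → IsFillingOf H′ y → IsFillingOf H v
  isFilling-insertCell r<Hc (inside , injective , surjective) = inside′ , injective′ , surjective′
    where
    inside′ : ∀ x → toℕ (lookup v x) < H x
    inside′ x with punchIn-cases c x
    ... | inj₁ refl = subst (λ z → toℕ z < H c) (sym (lookup-insertCell c r y)) r<Hc
    ... | inj₂ (j , refl) =
      subst (λ z → toℕ z < H (punchIn c j)) (sym (v-punchIn j)) (to (minor j (lookup y j)) (inside j))
    injective′ : ∀ x x′ → lookup v x ≡ lookup v x′ → x ≡ x′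
    injective′ x x′ eq with punchIn-cases c x | punchIn-cases c x′
    ... | inj₁ refl       | inj₁ refl        = refl
    ... | inj₁ refl       | inj₂ (j′ , refl) = contradiction (trans (sym eq) (lookup-insertCell c r y)) (v-punchIn≢r j′)
    ... | inj₂ (j , refl) | inj₁ refl        = contradiction (trans eq (lookup-insertCell c r y)) (v-punchIn≢r j)
    ... | inj₂ (j , refl) | inj₂ (j′ , refl) = cong (punchIn c)
      (injective j j′ (punchIn-injective r _ _ (trans (sym (v-punchIn j)) (trans eq (v-punchIn j′)))))
    surjective′ : ∀ t → ∃ λ x → lookup v x ≡ t
    surjective′ t with punchIn-cases r t
    ... | inj₁ refl = c , lookup-insertCell c r y
    ... | inj₂ (s , refl) with j , ys≡s ← surjective s =
      punchIn c j , trans (v-punchIn j) (cong (punchIn r) ys≡s)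

  isFilling-removeCell : IsFillingOf H v → IsFillingOf H′ y
  isFilling-removeCell (inside , injective , surjective) = inside′ , injective′ , surjective′
    where
    inside′ : ∀ j → toℕ (lookup y j) < H′ j
    inside′ j = from (minor j (lookup y j)) (subst (λ z → toℕ z < H (punchIn c j)) (v-punchIn j) (inside (punchIn c j)))
    injective′ : ∀ j j′ → lookup y j ≡ lookup y j′ → j ≡ j′
    injective′ j j′ eq =
      punchIn-injective c j j′ (injective _ _ (trans (v-punchIn j) (trans (cong (punchIn r) eq) (sym (v-punchIn j′)))))
    surjective′ : ∀ s → ∃ λ j → lookup y j ≡ s
    surjective′ s with x , vx≡ ← surjective (punchIn r s) | punchIn-cases c x
    ... | inj₁ refl = contradiction (trans (sym vx≡) (lookup-insertCell c r y)) (punchInᵢ≢i r s)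
    ... | inj₂ (j , refl) = j , punchIn-injective r _ _ (trans (sym (v-punchIn j)) vx≡)

  occurrence-insertCell : ∀ {k} (q : Vec (Fin k) k) → Occurrence H′ q y → Occurrence H q v
  occurrence-insertCell q (cs , rs , cs-increasing , rs-increasing , inside , matches) =
    Vec.map (punchIn c) cs , Vec.map (punchIn r) rs , cs′-increasing , rs′-increasing , inside′ , matches′
    where
    cs′-increasing : StrictlyIncreasing (Vec.map (punchIn c) cs)
    cs′-increasing a b a<b rewrite lookup-map a (punchIn c) cs | lookup-map b (punchIn c) cs =
      punchIn-mono-< c (cs-increasing a b a<b)
    rs′-increasing : StrictlyIncreasing (Vec.map (punchIn r) rs)
    rs′-increasing a b a<b rewrite lookup-map a (punchIn r) rs | lookup-map b (punchIn r) rs =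
      punchIn-mono-< r (rs-increasing a b a<b)
    inside′ : ∀ a b → toℕ (lookup (Vec.map (punchIn r) rs) b) < H (lookup (Vec.map (punchIn c) cs) a)
    inside′ a b rewrite lookup-map a (punchIn c) cs | lookup-map b (punchIn r) rs = to (minor _ _) (inside a b)
    matches′ : ∀ a b →
      (lookup v (lookup (Vec.map (punchIn c) cs) a) ≡ lookup (Vec.map (punchIn r) rs) b) ⇔ (lookup q a ≡ b)
    matches′ a b rewrite lookup-map a (punchIn c) cs | lookup-map b (punchIn r) rs | v-punchIn (lookup cs a) =
      mk⇔ (to (matches a b) ∘ punchIn-injective r _ _) (cong (punchIn r) ∘ from (matches a b))

  occurrence-removeCell : ∀ {k} (q : Vec (Fin k) k) → IsPermutation q → (o : Occurrence H q v) →
    (∀ a → lookup (proj₁ o) a ≢ c) → Occurrence H′ q y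
  occurrence-removeCell {k} q (_ , q-surjective) (cs , rs , cs-increasing , rs-increasing , inside , matches) avoids-c =
    cs′ , rs′ , cs′-increasing , rs′-increasing , inside′ , matches′
    where
    c≢ : ∀ a → c ≢ lookup cs a
    c≢ a = avoids-c a ∘ sym
    r≢ : ∀ b → r ≢ lookup rs b
    r≢ b r≡ with a , qa≡b ← q-surjective b | punchIn-cases c (lookup cs a)
    ... | inj₁ csa≡c = avoids-c a csa≡c
    ... | inj₂ (j , csa≡) =
      v-punchIn≢r j (trans (cong (lookup v) (sym csa≡)) (trans (from (matches a b) qa≡b) (sym r≡)))
    cs′ = Vec.tabulate (λ a → punchOut (c≢ a))
    rs′ = Vec.tabulate (λ b → punchOut (r≢ b))
    cs′-lookup : ∀ a → lookup cs′ a ≡ punchOut (c≢ a)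
    cs′-lookup = lookup∘tabulate (λ a → punchOut (c≢ a))
    rs′-lookup : ∀ b → lookup rs′ b ≡ punchOut (r≢ b)
    rs′-lookup = lookup∘tabulate (λ b → punchOut (r≢ b))
    cs′-increasing : StrictlyIncreasing cs′
    cs′-increasing a b a<b rewrite cs′-lookup a | cs′-lookup b = punchOut-mono-< (c≢ a) (c≢ b) (cs-increasing a b a<b)
    rs′-increasing : StrictlyIncreasing rs′
    rs′-increasing a b a<b rewrite rs′-lookup a | rs′-lookup b = punchOut-mono-< (r≢ a) (r≢ b) (rs-increasing a b a<b)
    inside′ : ∀ a b → toℕ (lookup rs′ b) < H′ (lookup cs′ a)
    inside′ a b rewrite cs′-lookup a | rs′-lookup b = from (minor _ _)
      (subst₂ (λ s d → toℕ s < H d) (sym (punchIn-punchOut (r≢ b))) (sym (punchIn-punchOut (c≢ a))) (inside a b))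
    v-cs : ∀ a → lookup v (lookup cs a) ≡ punchIn r (lookup y (punchOut (c≢ a)))
    v-cs a = trans (cong (lookup v) (sym (punchIn-punchOut (c≢ a)))) (v-punchIn _)
    rs≡ : ∀ b → lookup rs b ≡ punchIn r (punchOut (r≢ b))
    rs≡ b = sym (punchIn-punchOut (r≢ b))
    matches′ : ∀ a b → (lookup y (lookup cs′ a) ≡ lookup rs′ b) ⇔ (lookup q a ≡ b)
    matches′ a b rewrite cs′-lookup a | rs′-lookup b = mk⇔
      (λ eq → to (matches a b) (trans (v-cs a) (trans (cong (punchIn r) eq) (sym (rs≡ b)))))
      (λ qa≡b → punchIn-injective r _ _ (trans (sym (v-cs a)) (trans (from (matches a b) qa≡b) (rs≡ b))))

  avoiding-insertCell : ∀ {k} {P : POP k} → toℕ r < H c → (Bad : Set) →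
    (IsFillingOf H v → ∀ q → IsPermutation q → CompatibleWith P q →
       (o : Occurrence H q v) → ∀ a → lookup (proj₁ o) a ≡ c → Bad) →
    (IsFillingOf H v → Bad → ContainsPOP H P v) →
    Avoiding H P v ⇔ (Avoiding H′ P y × ¬ Bad)
  avoiding-insertCell {P = P} r<Hc Bad through-c⇒Bad Bad⇒contains = mk⇔
    (λ (filling , avoids) →
       (isFilling-removeCell filling , λ q q-perm q-compat → avoids q q-perm q-compat ∘ occurrence-insertCell q) ,
       λ bad → let (q , q-perm , q-compat , o) = Bad⇒contains filling bad in avoids q q-perm q-compat o)
    (λ ((filling , avoids) , ¬bad) →
       isFilling-insertCell r<Hc filling , avoids′ (isFilling-insertCell r<Hc filling) avoids ¬bad)
    where
    avoids′ : IsFillingOf H v → Avoids H′ P y → ¬ Bad → Avoids H P v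
    avoids′ filling avoids ¬bad q q-perm q-compat o with any? (λ a → lookup (proj₁ o) a Fin.≟ c)
    ... | yes (a , csa≡c) = ¬bad (through-c⇒Bad filling q q-perm q-compat o a csa≡c)
    ... | no  avoids-c    = avoids q q-perm q-compat (occurrence-removeCell q q-perm o (λ a → avoids-c ∘ (a ,_)))

-- This is what remains after removing the top row and any column c reaching it: the columns
-- left of c reach the top row too, so they are cut down to height m either way.
belowTop : ∀ {m} → Shape (suc m) → Shape m
belowTop {m} H j = H (Fin.suc j) ⊓ m

minor-topRow : ∀ {m} {H : Shape (suc m)} → Decreasing H → ∀ {c} → m < H c →
  Minor H c (fromℕ m) (belowTop H)
minor-topRow {m} {H} H-decreasing {c} m<Hc j s rewrite toℕ-punchIn-fromℕ s with punchIn-below-or-suc c j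
... | inj₂ eq rewrite eq =
  mk⇔ (λ s<H⊓m → <-≤-trans s<H⊓m (m⊓n≤m _ m)) (λ s<H → ⊓-pres-m< s<H (toℕ<n s))
... | inj₁ (j<c , eq) = mk⇔
  (λ _ → <-≤-trans (<-trans (toℕ<n s) m<Hc) (H-decreasing (≤-trans (≤-reflexive eq) (<⇒≤ j<c))))
  (λ _ → ⊓-pres-m< (<-trans (toℕ<n s) (<-≤-trans m<Hc (H-decreasing j<c))) (toℕ<n s))

module TopRow (k : ℕ) (a : Fin (suc k)) {m} {H : Shape (suc m)} (H-decreasing : Decreasing H) where

  top : Fin (suc m)
  top = fromℕ m

  A D : ℕ
  A = toℕ a
  D = k ∸ A

  A≤k : A ≤ k
  A≤k = toℕ≤pred[n] a

  -- Room around c for the A entries of the pattern left of position a and, reaching the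
  -- top row, the D entries right of it.
  Room : Fin (suc m) → Set
  Room c = A ≤ toℕ c × ∃ λ d → toℕ c + D ≤ toℕ d × m < H d

  module _ (c : Fin (suc m)) (y : Vec (Fin m) m) where

    private
      v = insertCell c top y

    through-top⇒room : IsFillingOf H v → ∀ q → IsPermutation q → CompatibleWith (p₁ k a) q →
      (o : Occurrence H q v) → ∀ j → lookup (proj₁ o) j ≡ c → Room c
    through-top⇒room _ q q-permutation q-compatible (cs , rs , cs-increasing , rs-increasing , inside , matches) j csj≡c =
      A≤C , lookup cs (fromℕ k) , C+D≤last , m<H-last
      where
      rs-qj≡top : lookup rs (lookup q j) ≡ top
      rs-qj≡top = trans (sym (from (matches j (lookup q j)) refl))
                        (trans (cong (lookup v) csj≡c) (lookup-insertCell c top y))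
      qj≡qa : lookup q j ≡ lookup q a
      qj≡qa = trans (strictlyIncreasing-max rs rs-increasing (trans (cong toℕ rs-qj≡top) (toℕ-fromℕ m)))
                    (sym (compatible-top q q-permutation q-compatible (λ i i≢a → refl , i≢a)))
      csa≡c : lookup cs a ≡ c
      csa≡c = subst (λ i → lookup cs i ≡ c) (proj₁ q-permutation j a qj≡qa) csj≡c
      A≤C : A ≤ toℕ c
      A≤C = ≤-trans (m≤n+m A (toℕ (lookup cs Fin.zero)))
        (subst (λ e → toℕ (lookup cs Fin.zero) + A ≤ toℕ e) csa≡c
          (strictlyIncreasing-gap cs cs-increasing A {Fin.zero} {a} refl))
      C+D≤last : toℕ c + D ≤ toℕ (lookup cs (fromℕ k))
      C+D≤last = subst (λ e → toℕ e + D ≤ toℕ (lookup cs (fromℕ k))) csa≡c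
        (strictlyIncreasing-gap cs cs-increasing D {a} {fromℕ k} (trans (toℕ-fromℕ k) (sym (m+[n∸m]≡n A≤k))))
      m<H-last : m < H (lookup cs (fromℕ k))
      m<H-last = subst (_< H (lookup cs (fromℕ k))) (trans (cong toℕ rs-qj≡top) (toℕ-fromℕ m))
        (inside (fromℕ k) (lookup q j))

    room⇒containsPOP : (∀ x x′ → lookup v x ≡ lookup v x′ → x ≡ x′) → Room c → ContainsPOP H (p₁ k a) v
    room⇒containsPOP v-injective (A≤C , d , C+D≤d , m<Hd) =
      containsPOP-from-columns {H = H} {v = v} v-injective cs cs-increasing inside respects
      where
      C = toℕ c
      first≤d : ∀ (i : Fin (suc k)) → C ∸ A + toℕ i ≤ toℕ d
      first≤d i = begin
        C ∸ A + toℕ i          ≤⟨ +-monoʳ-≤ (C ∸ A) (toℕ≤pred[n] i) ⟩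
        C ∸ A + k              ≡⟨ cong (C ∸ A +_) (m+[n∸m]≡n A≤k) ⟨
        C ∸ A + (A + D)        ≡⟨ +-assoc (C ∸ A) A D ⟨
        C ∸ A + A + D          ≡⟨ cong (_+ D) (m∸n+n≡m A≤C) ⟩
        C + D                  ≤⟨ C+D≤d ⟩
        toℕ d                  ∎
        where open ≤-Reasoning
      column : Fin (suc k) → Fin (suc m)
      column i = fromℕ< (s≤s (≤-trans (first≤d i) (toℕ≤pred[n] d)))
      cs = Vec.tabulate column
      toℕ-cs : ∀ i → toℕ (lookup cs i) ≡ C ∸ A + toℕ i
      toℕ-cs i = trans (cong toℕ (lookup∘tabulate column i)) (toℕ-fromℕ< _)
      cs-increasing : StrictlyIncreasing cs
      cs-increasing i j i<j = subst₂ _<_ (sym (toℕ-cs i)) (sym (toℕ-cs j)) (+-monoʳ-< (C ∸ A) i<j)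
      inside : ∀ i j → toℕ (lookup v (lookup cs j)) < H (lookup cs i)
      inside i j = ≤-<-trans (toℕ≤pred[n] (lookup v (lookup cs j)))
                     (<-≤-trans m<Hd (H-decreasing (subst (_≤ toℕ d) (sym (toℕ-cs i)) (first≤d i))))
      csa≡c : lookup cs a ≡ c
      csa≡c = toℕ-injective (trans (toℕ-cs a) (m∸n+n≡m A≤C))
      v-csa≡m : toℕ (lookup v (lookup cs a)) ≡ m
      v-csa≡m = trans (cong (toℕ ∘ lookup v) csa≡c) (trans (cong toℕ (lookup-insertCell c top y)) (toℕ-fromℕ m))
      respects : ∀ i j → p₁ k a i j → toℕ (lookup v (lookup cs i)) < toℕ (lookup v (lookup cs j))
      respects i j (refl , i≢a) = subst (toℕ (lookup v (lookup cs i)) <_) (sym v-csa≡m)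
        (≤∧≢⇒< (toℕ≤pred[n] (lookup v (lookup cs i)))
          (λ v-csi≡m → i≢a (strictlyIncreasing-injective cs cs-increasing
                              (v-injective _ _ (toℕ-injective (trans v-csi≡m (sym v-csa≡m)))))))

  avoiding-insertTop : ∀ {c} y → m < H c →
    Avoiding H (p₁ k a) (insertCell c top y) ⇔ (Avoiding (belowTop H) (p₁ k a) y × ¬ Room c)
  avoiding-insertTop {c} y m<Hc =
    avoiding-insertCell (minor-topRow H-decreasing m<Hc) y (subst (_< H c) (sym (toℕ-fromℕ m)) m<Hc) (Room c)
      (through-top⇒room c y) (λ filling → room⇒containsPOP c y (proj₁ (proj₂ filling)))

  module _ {w} (w≤ : w ≤ suc m) (reaches-top : ∀ d → m < H d ⇔ toℕ d < w) where

    ¬room⇔unblocked : ∀ c → toℕ c < w → (¬ Room c) ⇔ Unblocked w A D (toℕ c)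
    ¬room⇔unblocked c c<w = mk⇔ ¬room⇒unblocked unblocked⇒¬room
      where
      C = toℕ c
      ¬room⇒unblocked : ¬ Room c → Unblocked w A D C
      ¬room⇒unblocked ¬room with C <? A | w ≤? C + D
      ... | yes C<A | _          = inj₁ C<A
      ... | no  _   | yes w≤C+D  = inj₂ w≤C+D
      ... | no  C≮A | no  w≰C+D  = ⊥-elim (¬room (≮⇒≥ C≮A , d , ≤-reflexive (sym toℕ-d) , m<Hd))
        where
        C+D<1+m : C + D < suc m
        C+D<1+m = <-≤-trans (≰⇒> w≰C+D) w≤
        d = fromℕ< C+D<1+m
        toℕ-d : toℕ d ≡ C + D
        toℕ-d = toℕ-fromℕ< C+D<1+m
        m<Hd : m < H d
        m<Hd = from (reaches-top d) (subst (_< w) (sym toℕ-d) (≰⇒> w≰C+D))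
      unblocked⇒¬room : Unblocked w A D C → ¬ Room c
      unblocked⇒¬room (inj₁ C<A)    (A≤C , _)              = <⇒≱ C<A A≤C
      unblocked⇒¬room (inj₂ w≤C+D) (_ , d , C+D≤d , m<Hd) =
        <⇒≱ (≤-<-trans C+D≤d (to (reaches-top d) m<Hd)) w≤C+D

    private
      Decomposition : Vec (Fin (suc m)) (suc m) → Set
      Decomposition x = ∃₂ λ c y →
        (toℕ c < w × Unblocked w A D (toℕ c)) × Avoiding (belowTop H) (p₁ k a) y × x ≡ insertCell c top y

      split : ∀ x → Avoiding H (p₁ k a) x → Decomposition x
      split x avoiding@((inside , injective , surjective) , _) =
        c , y , (c<w , to (¬room⇔unblocked c c<w) (proj₂ split′)) , proj₁ split′ , x≡
        where
        c = proj₁ (surjective top)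
        xc≡top = proj₂ (surjective top)
        y = proj₁ (removeCell x injective c)
        x≡ : x ≡ insertCell c top y
        x≡ = trans (proj₂ (removeCell x injective c)) (cong (λ r → insertCell c r y) xc≡top)
        m<Hc : m < H c
        m<Hc = subst (_< H c) (trans (cong toℕ xc≡top) (toℕ-fromℕ m)) (inside c)
        c<w = to (reaches-top c) m<Hc
        split′ = to (avoiding-insertTop y m<Hc) (subst (Avoiding H (p₁ k a)) x≡ avoiding)

      join : ∀ x → Decomposition x → Avoiding H (p₁ k a) x
      join x (c , y , (c<w , unblocked) , avoiding , refl) =
        from (avoiding-insertTop y (from (reaches-top c) c<w)) (avoiding , from (¬room⇔unblocked c c<w) unblocked)

    Card-avoiding-insertTop : ∀ {N} → Card (Avoiding {R = m} (belowTop H) (p₁ k a)) N →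
      Card (Avoiding {R = suc m} H (p₁ k a)) (w ⊓ k * N)
    Card-avoiding-insertTop {N} card = subst (λ s → Card (Avoiding H (p₁ k a)) (w ⊓ s * N)) (m+[n∸m]≡n A≤k)
      (Card-product (λ c y → insertCell c top y) insertCell-injective-atRow (λ x → mk⇔ (split x) (join x))
        (Card-unblocked A D w≤) card)

equinumerous-p₁-p₁last : ∀ k (a : Fin (suc k)) m (H : Shape m) → Decreasing H →
  Equinumerous m H (p₁ k a) (p₁ k (fromℕ k))
equinumerous-p₁-p₁last k a zero H _ =
  1 , Card-avoiding-empty H (p₁ k a) , Card-avoiding-empty H (p₁ k (fromℕ k))
equinumerous-p₁-p₁last k a (suc m) H H-decreasing
  with w , w≤ , reaches-top ← initialSegment (λ d → m < H d) (λ d → m <? H d)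
                                (λ m<Hd d′≤d → <-≤-trans m<Hd (H-decreasing d′≤d))
     | N , card-a , card-last ← equinumerous-p₁-p₁last k a m (belowTop H)
                                  (λ i≤j → ⊓-monoˡ-≤ m (H-decreasing (s≤s i≤j)))
  = w ⊓ k * N ,
    TopRow.Card-avoiding-insertTop k a H-decreasing w≤ reaches-top card-a ,
    TopRow.Card-avoiding-insertTop k (fromℕ k) H-decreasing w≤ reaches-top card-last

-- This is what remains after removing the last column and a row below its height: every
-- other column is at least as tall, so it loses exactly one cell.
leftOfLast : ∀ {m} → Shape (suc m) → Shape m
leftOfLast {m} H j = pred (H (punchIn (fromℕ m) j))

≤-lastColumn : ∀ {m} {H : Shape (suc m)} → Decreasing H → ∀ c → H (fromℕ m) ≤ H c
≤-lastColumn {m} H-decreasing c = H-decreasing (subst (toℕ c ≤_) (sym (toℕ-fromℕ m)) (toℕ≤pred[n] c))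

minor-lastColumn : ∀ {m} {H : Shape (suc m)} → Decreasing H → ∀ {r} → toℕ r < H (fromℕ m) →
  Minor H (fromℕ m) r (leftOfLast H)
minor-lastColumn {m} {H} H-decreasing {r} r<Hℓ j s =
  lemma (H (punchIn (fromℕ m) j)) (<-≤-trans r<Hℓ (≤-lastColumn H-decreasing (punchIn (fromℕ m) j)))
  where
  lemma : ∀ h → toℕ r < h → (toℕ s < pred h) ⇔ (toℕ (punchIn r s) < h)
  lemma (suc h) (s≤s r≤h) with punchIn-below-or-suc r s
  ... | inj₁ (s<r , eq) rewrite eq = mk⇔ m<n⇒m<1+n (λ _ → <-≤-trans s<r r≤h)
  ... | inj₂ eq         rewrite eq = mk⇔ s<s s<s⁻¹

columns-carrying : ∀ {n R k} {v : Vec (Fin R) n} → (∀ r → ∃ λ c → lookup v c ≡ r) →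
  (row : Fin k → Fin R) → (∀ {b b′} → row b ≡ row b′ → b ≡ b′) →
  Σ (Vec (Fin n) k) λ cs → StrictlyIncreasing cs ×
    (∀ j → ∃ λ b → lookup v (lookup cs j) ≡ row b) × (∀ b → ∃ λ j → lookup v (lookup cs j) ≡ row b)
columns-carrying {v = v} v-surjective row row-injective =
  sorted , sorted-increasing , carries-row , row-carried
  where
  column = λ b → proj₁ (v-surjective (row b))
  v-column = λ b → proj₂ (v-surjective (row b))
  column-injective : ∀ {b b′} → column b ≡ column b′ → b ≡ b′
  column-injective {b} {b′} eq = row-injective (trans (sym (v-column b)) (trans (cong (lookup v) eq) (v-column b′)))
  open Standardisation (standardise column column-injective)
  carries-row : ∀ j → ∃ λ b → lookup v (lookup sorted j) ≡ row b
  carries-row j with b , rank-b≡j ← proj₂ ranks-permutation j =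
    b , trans (cong (lookup v) (trans (cong (lookup sorted) (sym rank-b≡j)) (sorted-ranks b))) (v-column b)
  row-carried : ∀ b → ∃ λ j → lookup v (lookup sorted j) ≡ row b
  row-carried b = lookup ranks b , trans (cong (lookup v) (sorted-ranks b)) (v-column b)

InWindow : ∀ {m} → ℕ → ℕ → Fin m → Set
InWindow base k t = base ≤ toℕ t × toℕ t ≤ base + k

window-columns : ∀ {m} {H : Shape (suc m)} {v : Vec (Fin (suc m)) (suc m)} → Decreasing H → IsFillingOf H v →
  ∀ k base → base + k < H (fromℕ m) → H (fromℕ m) ≤ suc m →
  Σ (Vec (Fin (suc m)) (suc k)) λ cs → StrictlyIncreasing cs ×
    (∀ a b → toℕ (lookup v (lookup cs b)) < H (lookup cs a)) ×
    (∀ j → InWindow base k (lookup v (lookup cs j))) ×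
    (∀ t → InWindow base k t → ∃ λ j → lookup v (lookup cs j) ≡ t)
window-columns {m} {H} {v} H-decreasing (_ , _ , v-surjective) k base base+k<Hℓ Hℓ≤1+m =
  cs , cs-increasing , inside , in-window , covers
  where
  base+b<Hℓ : ∀ (b : Fin (suc k)) → base + toℕ b < H (fromℕ m)
  base+b<Hℓ b = ≤-<-trans (+-monoʳ-≤ base (toℕ≤pred[n] b)) base+k<Hℓ
  row : Fin (suc k) → Fin (suc m)
  row b = fromℕ< (<-≤-trans (base+b<Hℓ b) Hℓ≤1+m)
  toℕ-row : ∀ b → toℕ (row b) ≡ base + toℕ b
  toℕ-row b = toℕ-fromℕ< _
  row-injective : ∀ {b b′} → row b ≡ row b′ → b ≡ b′
  row-injective {b} {b′} eq =
    toℕ-injective (+-cancelˡ-≡ base _ _ (trans (sym (toℕ-row b)) (trans (cong toℕ eq) (toℕ-row b′))))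
  carrying = columns-carrying {v = v} v-surjective row row-injective
  cs = proj₁ carrying
  cs-increasing = proj₁ (proj₂ carrying)
  carries-row = proj₁ (proj₂ (proj₂ carrying))
  row-carried = proj₂ (proj₂ (proj₂ carrying))
  inside : ∀ a j → toℕ (lookup v (lookup cs j)) < H (lookup cs a)
  inside a j with b , eq ← carries-row j rewrite eq | toℕ-row b =
    <-≤-trans (base+b<Hℓ b) (≤-lastColumn H-decreasing (lookup cs a))
  in-window : ∀ j → InWindow base k (lookup v (lookup cs j))
  in-window j with b , eq ← carries-row j rewrite eq | toℕ-row b =
    m≤m+n base (toℕ b) , +-monoʳ-≤ base (toℕ≤pred[n] b)
  covers : ∀ t → InWindow base k t → ∃ λ j → lookup v (lookup cs j) ≡ t
  covers t (base≤t , t≤base+k) =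
    proj₁ (row-carried b) , trans (proj₂ (row-carried b)) (toℕ-injective (trans (toℕ-row b) base+b≡t))
    where
    b<1+k : toℕ t ∸ base < suc k
    b<1+k = s≤s (subst (toℕ t ∸ base ≤_) (m+n∸m≡n base k) (∸-monoˡ-≤ base t≤base+k))
    b : Fin (suc k)
    b = fromℕ< b<1+k
    base+b≡t : base + toℕ b ≡ toℕ t
    base+b≡t = trans (cong (base +_) (toℕ-fromℕ< b<1+k)) (m+[n∸m]≡n base≤t)

module LastColumn (k : ℕ) {m} {H : Shape (suc m)} (H-decreasing : Decreasing H)
                  (Hℓ≤1+m : H (fromℕ m) ≤ suc m) where

  ℓ : Fin (suc m)
  ℓ = fromℕ m

  g : ℕ
  g = H ℓ

  ℓ-lastPosition : ∀ (cs : Vec (Fin (suc m)) (suc k)) → StrictlyIncreasing cs →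
    ∀ {j} → lookup cs j ≡ ℓ → lookup cs (fromℕ k) ≡ ℓ
  ℓ-lastPosition cs cs-increasing {j} csj≡ℓ = subst (λ i → lookup cs i ≡ ℓ)
    (strictlyIncreasing-max cs cs-increasing (trans (cong toℕ csj≡ℓ) (toℕ-fromℕ m))) csj≡ℓ

  module _ (r : Fin (suc m)) (y : Vec (Fin m) m) where

    private
      v = insertCell ℓ r y
      vℓ≡r = lookup-insertCell ℓ r y

    through-last⇒room-above : IsFillingOf H v → ∀ q → IsPermutation q → CompatibleWith (p₂ k) q →
      (o : Occurrence H q v) → ∀ j → lookup (proj₁ o) j ≡ ℓ → toℕ r + k < g
    through-last⇒room-above _ q q-permutation q-compatible
                            (cs , rs , cs-increasing , rs-increasing , inside , matches) j csj≡ℓ =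
      ≤-<-trans (subst (λ t → toℕ t + k ≤ toℕ (lookup rs (fromℕ k))) rs0≡r
                   (strictlyIncreasing-gap rs rs-increasing k {Fin.zero} {fromℕ k} (toℕ-fromℕ k)))
                (subst (λ c → toℕ (lookup rs (fromℕ k)) < H c) csk≡ℓ (inside (fromℕ k) (fromℕ k)))
      where
      csk≡ℓ = ℓ-lastPosition cs cs-increasing csj≡ℓ
      rs0≡r : lookup rs Fin.zero ≡ r
      rs0≡r = trans
        (sym (from (matches (fromℕ k) Fin.zero) (compatible-bottom q q-permutation q-compatible (λ i i≢k → refl , i≢k))))
        (trans (cong (lookup v) csk≡ℓ) vℓ≡r)

    through-last⇒room-below : IsFillingOf H v → ∀ q → IsPermutation q → CompatibleWith (p₁ k (fromℕ k)) q →
      (o : Occurrence H q v) → ∀ j → lookup (proj₁ o) j ≡ ℓ → k ≤ toℕ r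
    through-last⇒room-below _ q q-permutation q-compatible
                            (cs , rs , cs-increasing , rs-increasing , inside , matches) j csj≡ℓ =
      ≤-trans (m≤n+m k (toℕ (lookup rs Fin.zero)))
              (subst (λ t → toℕ (lookup rs Fin.zero) + k ≤ toℕ t) rsk≡r
                 (strictlyIncreasing-gap rs rs-increasing k {Fin.zero} {fromℕ k} (toℕ-fromℕ k)))
      where
      rsk≡r : lookup rs (fromℕ k) ≡ r
      rsk≡r = trans
        (sym (from (matches (fromℕ k) (fromℕ k)) (compatible-top q q-permutation q-compatible (λ i i≢k → refl , i≢k))))
        (trans (cong (lookup v) (ℓ-lastPosition cs cs-increasing csj≡ℓ)) vℓ≡r)

    module _ (v-filling : IsFillingOf H v) (base : ℕ) (base+k<g : base + k < g)
             (r-in-window : InWindow base k r) where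

      private
        v-injective = proj₁ (proj₂ v-filling)
        window = window-columns {H = H} {v = v} H-decreasing v-filling k base base+k<g Hℓ≤1+m
        cs = proj₁ window
        cs-increasing = proj₁ (proj₂ window)
        inside = proj₁ (proj₂ (proj₂ window))
        in-window = proj₁ (proj₂ (proj₂ (proj₂ window)))
        covers = proj₂ (proj₂ (proj₂ (proj₂ window)))
        csk≡ℓ : lookup cs (fromℕ k) ≡ ℓ
        csk≡ℓ = ℓ-lastPosition cs cs-increasing
                  (v-injective _ _ (trans (proj₂ (covers r r-in-window)) (sym vℓ≡r)))
        v-csk≡r : lookup v (lookup cs (fromℕ k)) ≡ r
        v-csk≡r = trans (cong (lookup v) csk≡ℓ) vℓ≡r
        v-cs≢r : ∀ j → j ≢ fromℕ k → toℕ (lookup v (lookup cs j)) ≢ toℕ r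
        v-cs≢r j j≢k eq = j≢k (strictlyIncreasing-injective cs cs-increasing
                                 (v-injective _ _ (trans (toℕ-injective eq) (sym v-csk≡r))))

      window⇒containsPOP-p₂ : base ≡ toℕ r → ContainsPOP H (p₂ k) v
      window⇒containsPOP-p₂ base≡r =
        containsPOP-from-columns {H = H} {v = v} v-injective cs cs-increasing inside respects
        where
        respects : ∀ i j → p₂ k i j → toℕ (lookup v (lookup cs i)) < toℕ (lookup v (lookup cs j))
        respects i j (refl , j≢k) rewrite v-csk≡r =
          ≤∧≢⇒< (subst (_≤ toℕ (lookup v (lookup cs j))) base≡r (proj₁ (in-window j)))
                (≢-sym (v-cs≢r j j≢k))

      window⇒containsPOP-p₁last : base + k ≡ toℕ r → ContainsPOP H (p₁ k (fromℕ k)) v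
      window⇒containsPOP-p₁last base+k≡r =
        containsPOP-from-columns {H = H} {v = v} v-injective cs cs-increasing inside respects
        where
        respects : ∀ i j → p₁ k (fromℕ k) i j → toℕ (lookup v (lookup cs i)) < toℕ (lookup v (lookup cs j))
        respects i j (refl , i≢k) rewrite v-csk≡r =
          ≤∧≢⇒< (subst (toℕ (lookup v (lookup cs i)) ≤_) base+k≡r (proj₂ (in-window i))) (v-cs≢r i i≢k)

  module _ {P : POP (suc k)} {N : ℕ} (Bad : ℕ → Set) (A D : ℕ) (A+D≡k : A + D ≡ k)
           (avoiding-insertLast : ∀ {r} (y : Vec (Fin m) m) → toℕ r < g →
              Avoiding H P (insertCell ℓ r y) ⇔ (Avoiding (leftOfLast H) P y × ¬ Bad (toℕ r)))
           (¬bad⇔unblocked : ∀ t → t < g → (¬ Bad t) ⇔ Unblocked g A D t) where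

    private
      Decomposition : Vec (Fin (suc m)) (suc m) → Set
      Decomposition x = ∃₂ λ r y →
        (toℕ r < g × Unblocked g A D (toℕ r)) × Avoiding (leftOfLast H) P y × x ≡ insertCell ℓ r y

      split : ∀ x → Avoiding H P x → Decomposition x
      split x avoiding@((inside , injective , _) , _) =
        lookup x ℓ , y , (inside ℓ , to (¬bad⇔unblocked _ (inside ℓ)) (proj₂ split′)) , proj₁ split′ , x≡
        where
        y = proj₁ (removeCell x injective ℓ)
        x≡ = proj₂ (removeCell x injective ℓ)
        split′ = to (avoiding-insertLast y (inside ℓ)) (subst (Avoiding H P) x≡ avoiding)

      join : ∀ x → Decomposition x → Avoiding H P x
      join x (r , y , (r<g , unblocked) , avoiding , refl) =
        from (avoiding-insertLast y r<g) (avoiding , from (¬bad⇔unblocked _ r<g) unblocked)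

    Card-avoiding-insertLast : Card (Avoiding {R = m} (leftOfLast H) P) N →
      Card (Avoiding {R = suc m} H P) (g ⊓ k * N)
    Card-avoiding-insertLast card = subst (λ s → Card (Avoiding H P) (g ⊓ s * N)) A+D≡k
      (Card-product (insertCell ℓ) insertCell-injective-atColumn (λ x → mk⇔ (split x) (join x))
        (Card-unblocked A D Hℓ≤1+m) card)

  Card-avoiding-insertLast-p₂ : ∀ {N} → Card (Avoiding {R = m} (leftOfLast H) (p₂ k)) N →
    Card (Avoiding {R = suc m} H (p₂ k)) (g ⊓ k * N)
  Card-avoiding-insertLast-p₂ =
    Card-avoiding-insertLast (λ t → t + k < g) 0 k refl avoiding-insertLast ¬room⇔unblocked
    where
    avoiding-insertLast : ∀ {r} (y : Vec (Fin m) m) → toℕ r < g →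
      Avoiding H (p₂ k) (insertCell ℓ r y) ⇔ (Avoiding (leftOfLast H) (p₂ k) y × ¬ (toℕ r + k < g))
    avoiding-insertLast {r} y r<g =
      avoiding-insertCell (minor-lastColumn H-decreasing r<g) y r<g (toℕ r + k < g)
        (through-last⇒room-above r y)
        (λ filling r+k<g → window⇒containsPOP-p₂ r y filling (toℕ r) r+k<g (≤-refl , m≤m+n (toℕ r) k) refl)
    ¬room⇔unblocked : ∀ t → t < g → (¬ (t + k < g)) ⇔ Unblocked g 0 k t
    ¬room⇔unblocked t _ = mk⇔ (inj₂ ∘ ≮⇒≥) λ where
      (inj₁ ())
      (inj₂ g≤t+k) t+k<g → <⇒≱ t+k<g g≤t+k

  Card-avoiding-insertLast-p₁last : ∀ {N} → Card (Avoiding {R = m} (leftOfLast H) (p₁ k (fromℕ k))) N →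
    Card (Avoiding {R = suc m} H (p₁ k (fromℕ k))) (g ⊓ k * N)
  Card-avoiding-insertLast-p₁last =
    Card-avoiding-insertLast (k ≤_) k 0 (+-identityʳ k) avoiding-insertLast ¬room⇔unblocked
    where
    avoiding-insertLast : ∀ {r} (y : Vec (Fin m) m) → toℕ r < g →
      Avoiding H (p₁ k (fromℕ k)) (insertCell ℓ r y) ⇔
        (Avoiding (leftOfLast H) (p₁ k (fromℕ k)) y × ¬ (k ≤ toℕ r))
    avoiding-insertLast {r} y r<g =
      avoiding-insertCell (minor-lastColumn H-decreasing r<g) y r<g (k ≤ toℕ r)
        (through-last⇒room-below r y)
        (λ filling k≤r → let r-k+k≡r = m∸n+n≡m k≤r in
          window⇒containsPOP-p₁last r y filling (toℕ r ∸ k) (subst (_< g) (sym r-k+k≡r) r<g)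
            (m∸n≤m (toℕ r) k , ≤-reflexive (sym r-k+k≡r)) r-k+k≡r)
    ¬room⇔unblocked : ∀ t → t < g → (¬ (k ≤ t)) ⇔ Unblocked g k 0 t
    ¬room⇔unblocked t t<g = mk⇔ (inj₁ ∘ ≰⇒>) λ where
      (inj₁ t<k)    k≤t → <⇒≱ t<k k≤t
      (inj₂ g≤t+0) _   → <⇒≱ t<g (subst (g ≤_) (+-identityʳ t) g≤t+0)

equinumerous-p₂-p₁last : ∀ k m (H : Shape m) → Decreasing H → (∀ c → H c ≤ m) →
  Equinumerous m H (p₂ k) (p₁ k (fromℕ k))
equinumerous-p₂-p₁last k zero H _ _ =
  1 , Card-avoiding-empty H (p₂ k) , Card-avoiding-empty H (p₁ k (fromℕ k))
equinumerous-p₂-p₁last k (suc m) H H-decreasing H-bounded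
  with N , card-p₂ , card-p₁last ← equinumerous-p₂-p₁last k m (leftOfLast H)
         (λ {i} {j} i≤j → pred-mono-≤ (H-decreasing (punchIn-mono-≤ (fromℕ m) i j i≤j)))
         (λ c → pred-mono-≤ (H-bounded (punchIn (fromℕ m) c)))
  = H (fromℕ m) ⊓ k * N ,
    LastColumn.Card-avoiding-insertLast-p₂ k H-decreasing (H-bounded (fromℕ m)) card-p₂ ,
    LastColumn.Card-avoiding-insertLast-p₁last k H-decreasing (H-bounded (fromℕ m)) card-p₁last

equinumerous-p₁-p₂ : ∀ k (a : Fin (suc k)) n R (H : Shape n) → Decreasing H → (∀ c → H c ≤ R) →
  Equinumerous R H (p₁ k a) (p₂ k)
equinumerous-p₁-p₂ k a n R H H-decreasing H-bounded with n ≟ R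
... | no n≢R = equinumerous-nonSquare n≢R
... | yes refl
  with N , card-p₁ , card-p₁last ← equinumerous-p₁-p₁last k a n H H-decreasing
     | _ , card-p₂ , card-p₁last′ ← equinumerous-p₂-p₁last k n H H-decreasing H-bounded
  = N , card-p₁ , subst (Card _) (Card-unique card-p₁last′ card-p₁last) card-p₂

height≤rows : ∀ {n} (H : Shape n) → Decreasing H → ∀ c → H c ≤ rowsOf n H
height≤rows {suc n} H H-decreasing c = H-decreasing z≤n

theorem3p2 : ∀ (k : ℕ) (a : Fin (suc k)) → ShapeWilfEquivalent (p₁ k a) (p₂ k)
theorem3p2 k a B =
  equinumerous-p₁-p₂ k a (n B) (rows B) (h B) (weakly-decreasing B) (height≤rows (h B) (weakly-decreasing B))
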